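{- Let $m\ge3$ and let $S$ be an $I(m,m-2)$ admissible set. For $1\le i<j\le m$ let $v(i,j)$ be the unique element of $S$ with $v(i,j)_i=v(i,j)_j=0$, and colour each triple $1\le i<j<k\le m$ by $c_S(\{i,j,k\})=(v(i,j)_k,\, v(i,k)_j,\, v(j,k)_i)\in\{1,2\}^3$. If all triples have the same colour and this colour lies in $\{111,112,122,211,221,222\}$, then $m\le3$. If all triples have the same colour and this colour lies in $\{121,212\}$, then $m\le5$.
   Context: $[m]=\{1,\dots,m\}$. For $v\in\{0,1,2\}^m$, $\mathrm{Supp}\, v=\{i: v_i\neq0\}$; $V_S$ is the set of vectors with support exactly $S$. A subset of $\{0,1,2\}^m$ is $I(m,w)$ if it contains exactly one element of $V_T$ for each $T\subseteq[m]$ with $|T|=w$ and no other elements. Two vectors form a clash if the support of one is contained in that of the other; three vectors $v_1,v_2,v_3$ form a clash if there is no coordinate at which exactly one of them is non-zero and no coordinate at which their three values are pairwise distinct. A set is admissible if it contains no clash (of two distinct or three distinct elements). A colour such as $121$ denotes the triple $(1,2,1)$. -}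

module Defs where

open import Data.Nat using (ℕ; _∸_)
open import Data.Fin using (Fin; zero; suc; _<_)
open import Data.Fin.Subset using (Subset; ∣_∣; _⊆_)
open import Data.Vec using (Vec; map; lookup)
open import Data.Bool using (Bool; true; false)
open import Data.Product using (Σ; _×_; _,_)
open import Data.List using (List; []; _∷_)
open import Relation.Binary.PropositionalEquality using (_≡_; _≢_)
open import Relation.Nullary using (¬_)

𝟘 𝟙 𝟚 : Fin 3
𝟘 = zero
𝟙 = suc zero
𝟚 = suc (suc zero)

Word : ℕ → Set
Word m = Vec (Fin 3) m

isNonZero : Fin 3 → Bool
isNonZero zero    = false
isNonZero (suc _) = true

Supp : ∀ {m} → Word m → Subset m
Supp v = map isNonZero v

WordSet : ℕ → Set₁
WordSet m = Word m → Set

IsI : (m w : ℕ) → WordSet m → Set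
IsI m w S =
  (∀ v → S v → ∣ Supp v ∣ ≡ w) ×
  (∀ (T : Subset m) → ∣ T ∣ ≡ w →
     Σ (Word m) λ v → (S v × Supp v ≡ T) ×
       (∀ u → S u → Supp u ≡ T → u ≡ v))

ExactlyOneNonZero : Fin 3 → Fin 3 → Fin 3 → Set
ExactlyOneNonZero a b c =
  (a ≢ 𝟘 × b ≡ 𝟘 × c ≡ 𝟘) Data.Sum.⊎ ((a ≡ 𝟘 × b ≢ 𝟘 × c ≡ 𝟘) Data.Sum.⊎ (a ≡ 𝟘 × b ≡ 𝟘 × c ≢ 𝟘))
  where import Data.Sum

PairwiseDistinct : Fin 3 → Fin 3 → Fin 3 → Set
PairwiseDistinct a b c = a ≢ b × a ≢ c × b ≢ c

Clash2 : ∀ {m} → Word m → Word m → Set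
Clash2 u v = (Supp u ⊆ Supp v) Data.Sum.⊎ (Supp v ⊆ Supp u)
  where import Data.Sum

Clash3 : ∀ {m} → Word m → Word m → Word m → Set
Clash3 u v w =
  (∀ i → ¬ ExactlyOneNonZero (lookup u i) (lookup v i) (lookup w i)) ×
  (∀ i → ¬ PairwiseDistinct (lookup u i) (lookup v i) (lookup w i))

Admissible : ∀ {m} → WordSet m → Set
Admissible {m} S =
  (∀ u v → S u → S v → u ≢ v → ¬ Clash2 u v) ×
  (∀ u v w → S u → S v → S w → u ≢ v → u ≢ w → v ≢ w → ¬ Clash3 u v w)

Colour : Set
Colour = Fin 3 × Fin 3 × Fin 3

-- every triple i<j<k has colour c_S({i,j,k}) = (v(i,j)_k, v(i,k)_j, v(j,k)_i) equal to col,
-- where v(i,j) is (any, hence the unique) element of S vanishing at i and j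
AllTriplesColoured : ∀ {m} → WordSet m → Colour → Set
AllTriplesColoured {m} S col =
  ∀ (i j k : Fin m) → i < j → j < k →
  ∀ (a b d : Word m) → S a → S b → S d →
  lookup a i ≡ 𝟘 → lookup a j ≡ 𝟘 →
  lookup b i ≡ 𝟘 → lookup b k ≡ 𝟘 →
  lookup d j ≡ 𝟘 → lookup d k ≡ 𝟘 →
  (lookup a k , lookup b j , lookup d i) ≡ col

colours₁ : List Colour
colours₁ = (𝟙 , 𝟙 , 𝟙) ∷ (𝟙 , 𝟙 , 𝟚) ∷ (𝟙 , 𝟚 , 𝟚) ∷ (𝟚 , 𝟙 , 𝟙) ∷ (𝟚 , 𝟚 , 𝟙) ∷ (𝟚 , 𝟚 , 𝟚) ∷ []

colours₂ : List Colour
colours₂ = (𝟙 , 𝟚 , 𝟙) ∷ (𝟚 , 𝟙 , 𝟚) ∷ []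

{-# OPTIONS --safe #-}
module Submission where

-- Let v(i,j) be the word of S vanishing exactly at i and j. A constant colour (x , y , z)
-- pins down all the remaining entries: for i < j, v(i,j)ₖ is x if k lies above j, y if
-- k lies between i and j, and z if k lies below i. Three words clash when at every
-- coordinate either none of them vanishes (there are only two nonzero letters), all
-- vanish, or exactly one vanishes and the other two agree.
-- For a < b < c < d this happens for v(a,b), v(a,c), v(a,d) when x = y, and for v(a,d),
-- v(b,d), v(c,d) when y = z; for a < b < c < d < e < f it happens for v(a,b), v(c,d),
-- v(e,f) when x = z.

open import Defs
open import Data.Nat as ℕ using (ℕ; _≤_; _∸_; z<s; s<s; s≤s)
open import Data.Nat.Properties using (≮⇒≥)
open import Data.Product using (_×_; _,_; proj₁; proj₂)
open import Data.Sum using (_⊎_; inj₁; inj₂; [_,_])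
open import Data.List.Membership.Propositional using (_∈_)
open import Data.List.Relation.Unary.Any using (here; there)
open import Data.Fin using (Fin; zero; suc; _<_)
open import Data.Fin.Properties using (_≟_; <-trans; <⇒≢)
open import Data.Fin.Subset using (⁅_⁆; _∪_; ∁; ∣_∣; _∉_) renaming (_∈_ to _∈ₛ_)
open import Data.Fin.Subset.Properties
  using (∣∁p∣≡n∸∣p∣; ∣⁅x⁆∣≡1; ∪-identityˡ; ∪-identityʳ; x∈⁅x⁆; x≢y⇒x∉⁅y⁆;
         x∈p∪q⁺; x∈p∪q⁻; x∈p⇒x∉∁p; x∉p⇒x∈∁p)
open import Data.Vec using (_∷_; lookup) renaming (here to hereᵥ; there to thereᵥ)
open import Function using (_∘_)
open import Relation.Nullary using (¬_; yes; no; contradiction)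
open import Relation.Binary.PropositionalEquality
  using (_≡_; _≢_; refl; sym; trans; cong; subst; ≢-sym)

private
  variable
    m : ℕ

ClashAt : Fin 3 → Fin 3 → Fin 3 → Set
ClashAt a b c = ¬ ExactlyOneNonZero a b c × ¬ PairwiseDistinct a b c

clash3 : {u v w : Word m} →
         (∀ k → ClashAt (lookup u k) (lookup v k) (lookup w k)) → Clash3 u v w
clash3 clashAt = proj₁ ∘ clashAt , proj₂ ∘ clashAt

clashAt-zero₁ : ∀ {a b c} → a ≡ 𝟘 → b ≡ c → ClashAt a b c
clashAt-zero₁ refl refl =
  (λ { (inj₁ (a≢𝟘 , _)) → a≢𝟘 refl
     ; (inj₂ (inj₁ (_ , b≢𝟘 , b≡𝟘))) → b≢𝟘 b≡𝟘
     ; (inj₂ (inj₂ (_ , b≡𝟘 , b≢𝟘))) → b≢𝟘 b≡𝟘 }) ,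
  (λ (_ , _ , b≢b) → b≢b refl)

clashAt-zero₂ : ∀ {a b c} → b ≡ 𝟘 → a ≡ c → ClashAt a b c
clashAt-zero₂ refl refl =
  (λ { (inj₁ (a≢𝟘 , _ , a≡𝟘)) → a≢𝟘 a≡𝟘
     ; (inj₂ (inj₁ (_ , b≢𝟘 , _))) → b≢𝟘 refl
     ; (inj₂ (inj₂ (a≡𝟘 , _ , a≢𝟘))) → a≢𝟘 a≡𝟘 }) ,
  (λ (_ , a≢a , _) → a≢a refl)

clashAt-zero₃ : ∀ {a b c} → c ≡ 𝟘 → a ≡ b → ClashAt a b c
clashAt-zero₃ refl refl =
  (λ { (inj₁ (a≢𝟘 , a≡𝟘 , _)) → a≢𝟘 a≡𝟘
     ; (inj₂ (inj₁ (a≡𝟘 , a≢𝟘 , _))) → a≢𝟘 a≡𝟘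
     ; (inj₂ (inj₂ (_ , _ , c≢𝟘))) → c≢𝟘 refl }) ,
  (λ (a≢a , _ , _) → a≢a refl)

-- Pigeonhole: there are only two nonzero letters.
nonzero-¬pairwiseDistinct : ∀ {a b c} → a ≢ 𝟘 → b ≢ 𝟘 → c ≢ 𝟘 → ¬ PairwiseDistinct a b c
nonzero-¬pairwiseDistinct {zero} a≢𝟘 _ _ _ = a≢𝟘 refl
nonzero-¬pairwiseDistinct {suc _} {zero} _ b≢𝟘 _ _ = b≢𝟘 refl
nonzero-¬pairwiseDistinct {suc _} {suc _} {zero} _ _ c≢𝟘 _ = c≢𝟘 refl
nonzero-¬pairwiseDistinct {suc zero} {suc zero} _ _ _ (a≢b , _) = a≢b refl
nonzero-¬pairwiseDistinct {suc (suc zero)} {suc (suc zero)} _ _ _ (a≢b , _) = a≢b refl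
nonzero-¬pairwiseDistinct {suc zero} {suc (suc zero)} {suc zero} _ _ _ (_ , a≢c , _) = a≢c refl
nonzero-¬pairwiseDistinct {suc zero} {suc (suc zero)} {suc (suc zero)} _ _ _ (_ , _ , b≢c) = b≢c refl
nonzero-¬pairwiseDistinct {suc (suc zero)} {suc zero} {suc zero} _ _ _ (_ , _ , b≢c) = b≢c refl
nonzero-¬pairwiseDistinct {suc (suc zero)} {suc zero} {suc (suc zero)} _ _ _ (_ , a≢c , _) = a≢c refl

clashAt-nonzero : ∀ {a b c} → a ≢ 𝟘 → b ≢ 𝟘 → c ≢ 𝟘 → ClashAt a b c
clashAt-nonzero a≢𝟘 b≢𝟘 c≢𝟘 =
  (λ { (inj₁ (_ , b≡𝟘 , _)) → b≢𝟘 b≡𝟘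
     ; (inj₂ (inj₁ (a≡𝟘 , _))) → a≢𝟘 a≡𝟘
     ; (inj₂ (inj₂ (a≡𝟘 , _))) → a≢𝟘 a≡𝟘 }) ,
  nonzero-¬pairwiseDistinct a≢𝟘 b≢𝟘 c≢𝟘

∈Supp⇒≢𝟘 : {v : Word m} {k : Fin m} → k ∈ₛ Supp v → lookup v k ≢ 𝟘
∈Supp⇒≢𝟘 {v = zero ∷ _} {zero} ()
∈Supp⇒≢𝟘 {v = suc _ ∷ _} {zero} hereᵥ = λ ()
∈Supp⇒≢𝟘 {v = _ ∷ _} {suc _} (thereᵥ k∈Supp) = ∈Supp⇒≢𝟘 k∈Supp

∉Supp⇒≡𝟘 : {v : Word m} {k : Fin m} → k ∉ Supp v → lookup v k ≡ 𝟘
∉Supp⇒≡𝟘 {v = zero ∷ _} {zero} _ = refl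
∉Supp⇒≡𝟘 {v = suc _ ∷ _} {zero} k∉Supp = contradiction hereᵥ k∉Supp
∉Supp⇒≡𝟘 {v = _ ∷ _} {suc _} k∉Supp = ∉Supp⇒≡𝟘 (k∉Supp ∘ thereᵥ)

∣⁅x⁆∪⁅y⁆∣≡2 : {x y : Fin m} → x ≢ y → ∣ ⁅ x ⁆ ∪ ⁅ y ⁆ ∣ ≡ 2
∣⁅x⁆∪⁅y⁆∣≡2 {x = zero} {zero} x≢y = contradiction refl x≢y
∣⁅x⁆∪⁅y⁆∣≡2 {x = zero} {suc y} _ = cong ℕ.suc (trans (cong ∣_∣ (∪-identityˡ ⁅ y ⁆)) (∣⁅x⁆∣≡1 y))
∣⁅x⁆∪⁅y⁆∣≡2 {x = suc x} {zero} _ = cong ℕ.suc (trans (cong ∣_∣ (∪-identityʳ ⁅ x ⁆)) (∣⁅x⁆∣≡1 x))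
∣⁅x⁆∪⁅y⁆∣≡2 {x = suc _} {suc _} x≢y = ∣⁅x⁆∪⁅y⁆∣≡2 (x≢y ∘ cong suc)

∣∁⁅x⁆∪⁅y⁆∣≡n∸2 : {x y : Fin m} → x ≢ y → ∣ ∁ (⁅ x ⁆ ∪ ⁅ y ⁆) ∣ ≡ m ∸ 2
∣∁⁅x⁆∪⁅y⁆∣≡n∸2 {m} {x} {y} x≢y =
  trans (∣∁p∣≡n∸∣p∣ (⁅ x ⁆ ∪ ⁅ y ⁆)) (cong (m ∸_) (∣⁅x⁆∪⁅y⁆∣≡2 x≢y))

record PairWord (S : WordSet m) (i j : Fin m) : Set where
  field
    word : Word m
    ∈S : S word
    vanishesˡ : lookup word i ≡ 𝟘
    vanishesʳ : lookup word j ≡ 𝟘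
    nonzero : ∀ {k} → k ≢ i → k ≢ j → lookup word k ≢ 𝟘

open PairWord

pairWord : {S : WordSet m} → IsI m (m ∸ 2) S → {i j : Fin m} → i ≢ j → PairWord S i j
pairWord (_ , exactlyOne) {i} {j} i≢j
  with exactlyOne (∁ (⁅ i ⁆ ∪ ⁅ j ⁆)) (∣∁⁅x⁆∪⁅y⁆∣≡n∸2 i≢j)
... | v , (v∈S , Supp≡) , _ = record
  { word = v
  ; ∈S = v∈S
  ; vanishesˡ = vanishes (x∈p∪q⁺ (inj₁ (x∈⁅x⁆ i)))
  ; vanishesʳ = vanishes (x∈p∪q⁺ (inj₂ (x∈⁅x⁆ j)))
  ; nonzero = λ k≢i k≢j → ∈Supp⇒≢𝟘 (subst (_ ∈ₛ_) (sym Supp≡)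
      (x∉p⇒x∈∁p ([ x≢y⇒x∉⁅y⁆ k≢i , x≢y⇒x∉⁅y⁆ k≢j ] ∘ x∈p∪q⁻ _ _)))
  }
  where
  vanishes : ∀ {k} → k ∈ₛ ⁅ i ⁆ ∪ ⁅ j ⁆ → lookup v k ≡ 𝟘
  vanishes k∈ = ∉Supp⇒≡𝟘 (subst (_ ∉_) (sym Supp≡) (x∈p⇒x∉∁p k∈))

vanishing-≢ : {u v : Word m} {k : Fin m} → lookup u k ≡ 𝟘 → lookup v k ≢ 𝟘 → u ≢ v
vanishing-≢ uₖ≡𝟘 vₖ≢𝟘 refl = vₖ≢𝟘 uₖ≡𝟘

admissible⇒¬clashAt : {S : WordSet m} → Admissible S → {u v w : Word m} →
                      S u → S v → S w → u ≢ v → u ≢ w → v ≢ w →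
                      ¬ (∀ k → ClashAt (lookup u k) (lookup v k) (lookup w k))
admissible⇒¬clashAt (_ , noClash3) {u} {v} {w} u∈S v∈S w∈S u≢v u≢w v≢w clashAt =
  noClash3 u v w u∈S v∈S w∈S u≢v u≢w v≢w (clash3 {u = u} {v} {w} clashAt)

withIncreasing₄ : {P : Set} → 4 ≤ m →
                  (∀ {a b c d : Fin m} → a < b → b < c → c < d → P) → P
withIncreasing₄ (s≤s (s≤s (s≤s (s≤s _)))) chain =
  chain {zero} {suc zero} {suc (suc zero)} {suc (suc (suc zero))}
        z<s (s<s z<s) (s<s (s<s z<s))

withIncreasing₆ : {P : Set} → 6 ≤ m →
                  (∀ {a b c d e f : Fin m} → a < b → b < c → c < d → d < e → e < f → P) → P
withIncreasing₆ (s≤s (s≤s (s≤s (s≤s (s≤s (s≤s _)))))) chain =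
  chain {zero} {suc zero} {suc (suc zero)} {suc (suc (suc zero))}
        {suc (suc (suc (suc zero)))} {suc (suc (suc (suc (suc zero))))}
        z<s (s<s z<s) (s<s (s<s z<s)) (s<s (s<s (s<s z<s))) (s<s (s<s (s<s (s<s z<s))))

module ConstantColour {S : WordSet m} (isI : IsI m (m ∸ 2) S) (admissible : Admissible S)
                      {x y z : Fin 3} (coloured : AllTriplesColoured S (x , y , z)) where

  pair : {i j : Fin m} → i < j → PairWord S i j
  pair i<j = pairWord isI (<⇒≢ i<j)

  colour : {i j k : Fin m} → i < j → j < k →
           (u : PairWord S i j) (v : PairWord S i k) (w : PairWord S j k) →
           (lookup (word u) k , lookup (word v) j , lookup (word w) i) ≡ (x , y , z)
  colour i<j j<k u v w =
    coloured _ _ _ i<j j<k (word u) (word v) (word w) (∈S u) (∈S v) (∈S w)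
      (vanishesˡ u) (vanishesʳ u) (vanishesˡ v) (vanishesʳ v) (vanishesˡ w) (vanishesʳ w)

  above : {i j k : Fin m} → i < j → j < k → (u : PairWord S i j) → lookup (word u) k ≡ x
  above i<j j<k u = cong proj₁ (colour i<j j<k u (pair (<-trans i<j j<k)) (pair j<k))

  between : {i j k : Fin m} → i < j → j < k → (v : PairWord S i k) → lookup (word v) j ≡ y
  between i<j j<k v = cong (proj₁ ∘ proj₂) (colour i<j j<k (pair i<j) v (pair j<k))

  below : {i j k : Fin m} → i < j → j < k → (w : PairWord S j k) → lookup (word w) i ≡ z
  below i<j j<k w = cong (proj₂ ∘ proj₂) (colour i<j j<k (pair i<j) (pair (<-trans i<j j<k)) w)

  x≢y : {a b c d : Fin m} → a < b → b < c → c < d → x ≢ y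
  x≢y {a} {b} {c} {d} a<b b<c c<d x≡y =
    admissible⇒¬clashAt admissible (∈S u) (∈S v) (∈S w)
      (vanishing-≢ (vanishesʳ u) (nonzero v (≢-sym (<⇒≢ a<b)) (<⇒≢ b<c)))
      (vanishing-≢ (vanishesʳ u) (nonzero w (≢-sym (<⇒≢ a<b)) (<⇒≢ b<d)))
      (vanishing-≢ (vanishesʳ v) (nonzero w (≢-sym (<⇒≢ a<c)) (<⇒≢ c<d)))
      clashAt
    where
    a<c = <-trans a<b b<c
    b<d = <-trans b<c c<d
    u = pair a<b
    v = pair a<c
    w = pair (<-trans a<c c<d)
    clashAt : ∀ e → ClashAt (lookup (word u) e) (lookup (word v) e) (lookup (word w) e)
    clashAt e with e ≟ a | e ≟ b | e ≟ c | e ≟ d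
    ... | yes refl | _ | _ | _ =
      clashAt-zero₁ (vanishesˡ u) (trans (vanishesˡ v) (sym (vanishesˡ w)))
    ... | no _ | yes refl | _ | _ =
      clashAt-zero₁ (vanishesʳ u) (trans (between a<b b<c v) (sym (between a<b b<d w)))
    ... | no _ | no _ | yes refl | _ =
      clashAt-zero₂ (vanishesʳ v) (trans (above a<b b<c u) (trans x≡y (sym (between a<c c<d w))))
    ... | no _ | no _ | no _ | yes refl =
      clashAt-zero₃ (vanishesʳ w) (trans (above a<b b<d u) (sym (above a<c c<d v)))
    ... | no e≢a | no e≢b | no e≢c | no e≢d =
      clashAt-nonzero (nonzero u e≢a e≢b) (nonzero v e≢a e≢c) (nonzero w e≢a e≢d)

  y≢z : {a b c d : Fin m} → a < b → b < c → c < d → y ≢ z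
  y≢z {a} {b} {c} {d} a<b b<c c<d y≡z =
    admissible⇒¬clashAt admissible (∈S u) (∈S v) (∈S w)
      (vanishing-≢ (vanishesˡ u) (nonzero v (<⇒≢ a<b) (<⇒≢ a<d)))
      (vanishing-≢ (vanishesˡ u) (nonzero w (<⇒≢ a<c) (<⇒≢ a<d)))
      (vanishing-≢ (vanishesˡ v) (nonzero w (<⇒≢ b<c) (<⇒≢ b<d)))
      clashAt
    where
    a<c = <-trans a<b b<c
    a<d = <-trans a<c c<d
    b<d = <-trans b<c c<d
    u = pair a<d
    v = pair b<d
    w = pair c<d
    clashAt : ∀ e → ClashAt (lookup (word u) e) (lookup (word v) e) (lookup (word w) e)
    clashAt e with e ≟ a | e ≟ b | e ≟ c | e ≟ d
    ... | yes refl | _ | _ | _ =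
      clashAt-zero₁ (vanishesˡ u) (trans (below a<b b<d v) (sym (below a<c c<d w)))
    ... | no _ | yes refl | _ | _ =
      clashAt-zero₂ (vanishesˡ v) (trans (between a<b b<d u) (trans y≡z (sym (below b<c c<d w))))
    ... | no _ | no _ | yes refl | _ =
      clashAt-zero₃ (vanishesˡ w) (trans (between a<c c<d u) (sym (between b<c c<d v)))
    ... | no _ | no _ | no _ | yes refl =
      clashAt-zero₁ (vanishesʳ u) (trans (vanishesʳ v) (sym (vanishesʳ w)))
    ... | no e≢a | no e≢b | no e≢c | no e≢d =
      clashAt-nonzero (nonzero u e≢a e≢d) (nonzero v e≢b e≢d) (nonzero w e≢c e≢d)

  x≢z : {a b c d e f : Fin m} → a < b → b < c → c < d → d < e → e < f → x ≢ z
  x≢z {a} {b} {c} {d} {e} {f} a<b b<c c<d d<e e<f x≡z =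
    admissible⇒¬clashAt admissible (∈S u) (∈S v) (∈S w)
      (vanishing-≢ (vanishesˡ u) (nonzero v (<⇒≢ a<c) (<⇒≢ (<-trans a<c c<d))))
      (vanishing-≢ (vanishesˡ u) (nonzero w (<⇒≢ a<e) (<⇒≢ (<-trans a<e e<f))))
      (vanishing-≢ (vanishesˡ v) (nonzero w (<⇒≢ c<e) (<⇒≢ (<-trans c<e e<f))))
      clashAt
    where
    b<d = <-trans b<c c<d
    b<e = <-trans b<d d<e
    a<c = <-trans a<b b<c
    a<e = <-trans a<b b<e
    c<e = <-trans c<d d<e
    b<f = <-trans b<e e<f
    d<f = <-trans d<e e<f
    u = pair a<b
    v = pair c<d
    w = pair e<f
    clashAt : ∀ g → ClashAt (lookup (word u) g) (lookup (word v) g) (lookup (word w) g)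
    clashAt g with g ≟ a | g ≟ b | g ≟ c | g ≟ d | g ≟ e | g ≟ f
    ... | yes refl | _ | _ | _ | _ | _ =
      clashAt-zero₁ (vanishesˡ u) (trans (below a<c c<d v) (sym (below a<e e<f w)))
    ... | no _ | yes refl | _ | _ | _ | _ =
      clashAt-zero₁ (vanishesʳ u) (trans (below b<c c<d v) (sym (below b<e e<f w)))
    ... | no _ | no _ | yes refl | _ | _ | _ =
      clashAt-zero₂ (vanishesˡ v) (trans (above a<b b<c u) (trans x≡z (sym (below c<e e<f w))))
    ... | no _ | no _ | no _ | yes refl | _ | _ =
      clashAt-zero₂ (vanishesʳ v) (trans (above a<b b<d u) (trans x≡z (sym (below d<e e<f w))))
    ... | no _ | no _ | no _ | no _ | yes refl | _ =
      clashAt-zero₃ (vanishesˡ w) (trans (above a<b b<e u) (sym (above c<d d<e v)))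
    ... | no _ | no _ | no _ | no _ | no _ | yes refl =
      clashAt-zero₃ (vanishesʳ w) (trans (above a<b b<f u) (sym (above c<d d<f v)))
    ... | no g≢a | no g≢b | no g≢c | no g≢d | no g≢e | no g≢f =
      clashAt-nonzero (nonzero u g≢a g≢b) (nonzero v g≢c g≢d) (nonzero w g≢e g≢f)

  m≤3 : x ≡ y ⊎ y ≡ z → m ≤ 3
  m≤3 x≡y⊎y≡z = ≮⇒≥ λ 4≤m →
    [ withIncreasing₄ 4≤m x≢y , withIncreasing₄ 4≤m y≢z ] x≡y⊎y≡z

  m≤5 : x ≡ z → m ≤ 5
  m≤5 x≡z = ≮⇒≥ λ 6≤m → withIncreasing₆ 6≤m x≢z x≡z

∈colours₁⇒x≡y⊎y≡z : ∀ {x y z} → (x , y , z) ∈ colours₁ → x ≡ y ⊎ y ≡ z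
∈colours₁⇒x≡y⊎y≡z (here refl) = inj₁ refl
∈colours₁⇒x≡y⊎y≡z (there (here refl)) = inj₁ refl
∈colours₁⇒x≡y⊎y≡z (there (there (here refl))) = inj₂ refl
∈colours₁⇒x≡y⊎y≡z (there (there (there (here refl)))) = inj₂ refl
∈colours₁⇒x≡y⊎y≡z (there (there (there (there (here refl))))) = inj₁ refl
∈colours₁⇒x≡y⊎y≡z (there (there (there (there (there (here refl)))))) = inj₁ refl

∈colours₂⇒x≡z : ∀ {x y z} → (x , y , z) ∈ colours₂ → x ≡ z
∈colours₂⇒x≡z (here refl) = refl
∈colours₂⇒x≡z (there (here refl)) = refl

lemma7 : (m : ℕ) → 3 ≤ m → (S : WordSet m) → IsI m (m ∸ 2) S → Admissible S →
    (col : Colour) → AllTriplesColoured S col →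
      (col ∈ colours₁ → m ≤ 3) × (col ∈ colours₂ → m ≤ 5)
lemma7 m _ S isI admissible (x , y , z) coloured =
  m≤3 ∘ ∈colours₁⇒x≡y⊎y≡z , m≤5 ∘ ∈colours₂⇒x≡z
  where open ConstantColour isI admissible coloured
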